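{- Let $M=(E,\mathcal{I})$ be a matroid on a finite set $E$ with $r(M)>0$. Then the forming base family $F(M)$ is a partition of $\bigcup\mathcal{B}(M)$ if and only if $M$ is a unique expansion matroid.
   Context: $\mathcal{B}(M)$ is the family of bases (maximal independent sets) of $M$, $r(M)$ is the common cardinality of the bases, and for $X\subseteq E$, $r(X)$ denotes the rank of $X$ (maximum size of an independent subset of $X$). The secondary base family is $s(M)=\{A\in\mathcal{I}: |A|=r(M)-1\}$ (defined when $r(M)>0$). For $X\subseteq E$ let $K_M(X)=\{a\in E: r(X\cup\{a\})=r(X)+1\}$. The forming base family is $F(M)=\{K_M(X): X\in s(M)\}$. $M$ is a unique expansion matroid if for every $B\in\mathcal{B}(M)$ and every $A\in s(M)$, whenever $e_1,e_2\in B$ satisfy $A\cup\{e_1\}\in\mathcal{B}(M)$ and $A\cup\{e_2\}\in\mathcal{B}(M)$, we have $e_1=e_2$. A partition of a set $S$ is a family of nonempty pairwise disjoint subsets of $S$ whose union is $S$. -}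

module Defs where

open import Data.Nat using (ℕ; suc; _<_; _≤_)
open import Data.Fin using (Fin)
open import Data.Fin.Subset using (Subset; _∈_; _∉_; _⊆_; _∪_; ⁅_⁆; ∣_∣) renaming (⊥ to ∅)
open import Data.Product using (Σ; ∃; ∃-syntax; _×_)
open import Data.Sum using (_⊎_)
open import Data.Empty using (⊥)
open import Relation.Nullary using (¬_; Dec)
open import Relation.Binary.PropositionalEquality using (_≡_)
open import Function.Bundles using (_⇔_)

-- A matroid on the finite ground set E = Fin n, given by its independent sets.
-- Independence is required to be decidable (harmless: E is finite).
record Matroid (n : ℕ) : Set₁ where
  field
    Indep      : Subset n → Set
    indep-dec  : (A : Subset n) → Dec (Indep A)
    indep-∅    : Indep ∅
    indep-down : ∀ {A B} → A ⊆ B → Indep B → Indep A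
    indep-aug  : ∀ {A B} → Indep A → Indep B → ∣ A ∣ < ∣ B ∣ →
                 ∃[ e ] (e ∈ B × e ∉ A × Indep (A ∪ ⁅ e ⁆))

module _ {n : ℕ} (M : Matroid n) where
  open Matroid M

  IsBase : Subset n → Set
  IsBase B = Indep B × (∀ A → Indep A → B ⊆ A → B ≡ A)

  IsRank : Subset n → ℕ → Set
  IsRank X k = (∃[ A ] (A ⊆ X × Indep A × ∣ A ∣ ≡ k))
             × (∀ A → A ⊆ X → Indep A → ∣ A ∣ ≤ k)

  PositiveRank : Set
  PositiveRank = ∃[ B ] (IsBase B × 0 < ∣ B ∣)

  Secondary : Subset n → Set
  Secondary A = Indep A × ∃[ B ] (IsBase B × ∣ B ∣ ≡ suc ∣ A ∣)

  _∈K_ : Fin n → Subset n → Set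
  a ∈K X = ∃[ k ] (IsRank X k × IsRank (X ∪ ⁅ a ⁆) (suc k))

  InUnionOfBases : Fin n → Set
  InUnionOfBases a = ∃[ B ] (IsBase B × a ∈ B)

  -- F(M) = { K_M(X) : X ∈ s(M) } is a partition of ⋃ B(M):
  -- members nonempty, two members equal or disjoint, union is ⋃ B(M).
  FormingIsPartition : Set
  FormingIsPartition =
      (∀ X → Secondary X → ∃[ a ] (a ∈K X))
    × (∀ X Y → Secondary X → Secondary Y →
         (∀ a → (a ∈K X) ⇔ (a ∈K Y)) ⊎ (∀ a → a ∈K X → a ∈K Y → ⊥))
    × (∀ a → (∃[ X ] (Secondary X × a ∈K X)) ⇔ InUnionOfBases a)

  UniqueExpansion : Set
  UniqueExpansion = ∀ B A e₁ e₂ → IsBase B → Secondary A →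
    e₁ ∈ B → e₂ ∈ B → IsBase (A ∪ ⁅ e₁ ⁆) → IsBase (A ∪ ⁅ e₂ ⁆) → e₁ ≡ e₂

-- For an independent X, a ∈ K(X) just says that X ∪ {a} is independent with a ∉ X;
-- for a secondary X this means X ∪ {a} is a base. If two blocks K(X), K(Y) share an
-- element c and a ∈ K(X), then either {a, c} is independent, so it extends to a base
-- containing both a and c, which together with X violates unique expansion unless
-- a = c; or {a, c} is dependent, and then exchanging c for a in the base Y ∪ {c}
-- gives the base Y ∪ {a}, i.e. a ∈ K(Y). Conversely, if A ∪ {e₁} and A ∪ {e₂} are bases
-- with e₁ ≠ e₂ both in B, then e₁ lies in K(A) and in K(B − e₁), while e₂ lies in K(A)
-- but not in K(B − e₁), so these blocks neither coincide nor are disjoint.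
module Submission where

open import Defs
open import Data.Nat using (ℕ; zero; suc; _+_; _≤_; _<_; s≤s; _≤?_)
open import Data.Nat.Properties using (≤-trans; ≤-reflexive; ≤-<-trans; n≮n; m≤m+n; ≰⇒>; +-suc)
open import Data.Fin using (Fin; zero; suc; _≟_)
open import Data.Fin.Properties using (any?)
open import Data.Fin.Subset using (Subset; _∈_; _∉_; _⊆_; _∪_; ⁅_⁆; ∣_∣; _─_; _-_; inside; outside)
open import Data.Fin.Subset.Properties
  using (∪-identityʳ; x∈⁅x⁆; x∈⁅y⁆⇒x≡y; ⊆-refl; ⊆-trans; ⊆-antisym; p⊆q⇒∣p∣≤∣q∣; p⊂q⇒∣p∣<∣q∣;
         p⊆p∪q; q⊆p∪q; x∈p∪q⁻; x∈p∧x≢y⇒x∈p-y; p─q⊆p; _∈?_)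
open import Data.Vec using (_∷_; here; there)
open import Data.Product using (∃-syntax; _×_; _,_; proj₁; proj₂; uncurry)
open import Data.Sum using (_⊎_; inj₁; inj₂)
open import Data.Empty using (⊥; ⊥-elim)
open import Function using (_∘_)
open import Relation.Nullary using (¬_; Dec; yes; no; ¬?; _×-dec_)
open import Relation.Nullary.Decidable using (map′)
open import Relation.Binary.PropositionalEquality using (_≡_; refl; sym; trans; cong; subst)
open import Function.Bundles using (_⇔_; mk⇔; Equivalence)

x∉p⇒∣p∪⁅x⁆∣≡1+∣p∣ : ∀ {n} {p : Subset n} {x} → x ∉ p → ∣ p ∪ ⁅ x ⁆ ∣ ≡ suc ∣ p ∣
x∉p⇒∣p∪⁅x⁆∣≡1+∣p∣ {p = inside ∷ p}  {zero}  x∉p = ⊥-elim (x∉p here)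
x∉p⇒∣p∪⁅x⁆∣≡1+∣p∣ {p = outside ∷ p} {zero}  x∉p = cong (suc ∘ ∣_∣) (∪-identityʳ p)
x∉p⇒∣p∪⁅x⁆∣≡1+∣p∣ {p = inside ∷ p}  {suc x} x∉p = cong suc (x∉p⇒∣p∪⁅x⁆∣≡1+∣p∣ (x∉p ∘ there))
x∉p⇒∣p∪⁅x⁆∣≡1+∣p∣ {p = outside ∷ p} {suc x} x∉p = x∉p⇒∣p∪⁅x⁆∣≡1+∣p∣ (x∉p ∘ there)

x∈p─q⇒x∉q : ∀ {n} (p q : Subset n) {x} → x ∈ p ─ q → x ∉ q
x∈p─q⇒x∉q (s ∷ p) (inside ∷ q) {zero}  ()
x∈p─q⇒x∉q (s ∷ p) (t ∷ q)      {suc x} (there x∈p─q) (there x∈q) = x∈p─q⇒x∉q p q x∈p─q x∈q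

x∉p-x : ∀ {n} (p : Subset n) x → x ∉ p - x
x∉p-x p x x∈p-x = x∈p─q⇒x∉q p ⁅ x ⁆ x∈p-x (x∈⁅x⁆ x)

x∈p∪⁅x⁆ : ∀ {n} (p : Subset n) x → x ∈ p ∪ ⁅ x ⁆
x∈p∪⁅x⁆ p x = q⊆p∪q p ⁅ x ⁆ (x∈⁅x⁆ x)

x∈p∪⁅y⁆⁻ : ∀ {n} (p : Subset n) {x} y → x ∈ p ∪ ⁅ y ⁆ → x ∈ p ⊎ x ≡ y
x∈p∪⁅y⁆⁻ p y x∈ with x∈p∪q⁻ p ⁅ y ⁆ x∈
... | inj₁ x∈p = inj₁ x∈p
... | inj₂ x∈y = inj₂ (x∈⁅y⁆⇒x≡y y x∈y)

x∈p⇒⁅x⁆⊆p : ∀ {n} {p : Subset n} {x} → x ∈ p → ⁅ x ⁆ ⊆ p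
x∈p⇒⁅x⁆⊆p {x = x} x∈p y∈x with x∈⁅y⁆⇒x≡y x y∈x
... | refl = x∈p

∪-least : ∀ {n} {p q r : Subset n} → p ⊆ r → q ⊆ r → p ∪ q ⊆ r
∪-least {p = p} {q} p⊆r q⊆r x∈ with x∈p∪q⁻ p q x∈
... | inj₁ x∈p = p⊆r x∈p
... | inj₂ x∈q = q⊆r x∈q

x∈p⇒p-x∪⁅x⁆≡p : ∀ {n} {p : Subset n} {x} → x ∈ p → (p - x) ∪ ⁅ x ⁆ ≡ p
x∈p⇒p-x∪⁅x⁆≡p {p = p} {x} x∈p = ⊆-antisym (∪-least (p─q⊆p p ⁅ x ⁆) (x∈p⇒⁅x⁆⊆p x∈p)) p⊆
  where
  p⊆ : p ⊆ (p - x) ∪ ⁅ x ⁆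
  p⊆ {y} y∈p with y ≟ x
  ... | yes refl = x∈p∪⁅x⁆ (p - x) x
  ... | no y≢x  = p⊆p∪q ⁅ x ⁆ (x∈p∧x≢y⇒x∈p-y y∈p y≢x)

p⊆q∧∣q∣≤∣p∣⇒p≡q : ∀ {n} {p q : Subset n} → p ⊆ q → ∣ q ∣ ≤ ∣ p ∣ → p ≡ q
p⊆q∧∣q∣≤∣p∣⇒p≡q {p = p} {q} p⊆q ∣q∣≤∣p∣ = ⊆-antisym p⊆q q⊆p
  where
  q⊆p : q ⊆ p
  q⊆p {x} x∈q with x ∈? p
  ... | yes x∈p = x∈p
  ... | no x∉p  = ⊥-elim (n≮n _ (≤-<-trans ∣q∣≤∣p∣ (p⊂q⇒∣p∣<∣q∣ (p⊆q , x , x∈q , x∉p))))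

module _ {n : ℕ} (M : Matroid n) where
  open Matroid M

  _∈Kᴹ_ : Fin n → Subset n → Set
  a ∈Kᴹ X = _∈K_ M a X

  indep⇒∣∣≤∣base∣ : ∀ {A B} → Indep A → IsBase M B → ∣ A ∣ ≤ ∣ B ∣
  indep⇒∣∣≤∣base∣ {A} {B} iA (iB , maximal) with ∣ A ∣ ≤? ∣ B ∣
  ... | yes ∣A∣≤∣B∣ = ∣A∣≤∣B∣
  ... | no ∣A∣≰∣B∣ with indep-aug iB iA (≰⇒> ∣A∣≰∣B∣)
  ... | e , _ , e∉B , iBe = ⊥-elim (e∉B (subst (e ∈_) (sym (maximal _ iBe (p⊆p∪q ⁅ e ⁆))) (x∈p∪⁅x⁆ B e)))

  indep∧∣base∣≤∣∣⇒base : ∀ {A B} → Indep A → IsBase M B → ∣ B ∣ ≤ ∣ A ∣ → IsBase M A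
  indep∧∣base∣≤∣∣⇒base iA bB ∣B∣≤∣A∣ =
    iA , λ C iC A⊆C → p⊆q∧∣q∣≤∣p∣⇒p≡q A⊆C (≤-trans (indep⇒∣∣≤∣base∣ iC bB) ∣B∣≤∣A∣)

  extend-within : ∀ {I J} → Indep I → Indep J →
                  ∃[ K ] (I ⊆ K × K ⊆ I ∪ J × Indep K × ∣ J ∣ ≤ ∣ K ∣)
  extend-within {I} {J} iI iJ = go ∣ J ∣ iI (m≤m+n ∣ J ∣ ∣ I ∣)
    where
    go : ∀ k {I} → Indep I → ∣ J ∣ ≤ k + ∣ I ∣ →
         ∃[ K ] (I ⊆ K × K ⊆ I ∪ J × Indep K × ∣ J ∣ ≤ ∣ K ∣)
    go zero    {I} iI ∣J∣≤∣I∣ = I , ⊆-refl , p⊆p∪q J , iI , ∣J∣≤∣I∣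
    go (suc k) {I} iI ∣J∣≤k+∣I∣ with ∣ J ∣ ≤? ∣ I ∣
    ... | yes ∣J∣≤∣I∣ = I , ⊆-refl , p⊆p∪q J , iI , ∣J∣≤∣I∣
    ... | no ∣J∣≰∣I∣ with indep-aug iI iJ (≰⇒> ∣J∣≰∣I∣)
    ... | e , e∈J , e∉I , iIe
      with go k iIe (subst (λ m → ∣ J ∣ ≤ k + m) (sym (x∉p⇒∣p∪⁅x⁆∣≡1+∣p∣ e∉I))
                      (subst (∣ J ∣ ≤_) (sym (+-suc k ∣ I ∣)) ∣J∣≤k+∣I∣))
    ... | K , Ie⊆K , K⊆IeJ , iK , ∣J∣≤∣K∣ =
      K , ⊆-trans (p⊆p∪q ⁅ e ⁆) Ie⊆K , ⊆-trans K⊆IeJ IeJ⊆IJ , iK , ∣J∣≤∣K∣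
      where
      IeJ⊆IJ : (I ∪ ⁅ e ⁆) ∪ J ⊆ I ∪ J
      IeJ⊆IJ = ∪-least (∪-least (p⊆p∪q J) (x∈p⇒⁅x⁆⊆p (q⊆p∪q I J e∈J))) (q⊆p∪q I J)

  extend-to-base : ∀ {I B} → Indep I → IsBase M B → ∃[ K ] (IsBase M K × I ⊆ K)
  extend-to-base iI bB with extend-within iI (proj₁ bB)
  ... | K , I⊆K , _ , iK , ∣B∣≤∣K∣ = K , indep∧∣base∣≤∣∣⇒base iK bB ∣B∣≤∣K∣ , I⊆K

  indep⇒IsRank-∣∣ : ∀ {A} → Indep A → IsRank M A ∣ A ∣
  indep⇒IsRank-∣∣ {A} iA = (A , ⊆-refl , iA , refl) , λ _ B⊆A _ → p⊆q⇒∣p∣≤∣q∣ B⊆A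

  ∉∧indep⇒∈K : ∀ {X a} → a ∉ X → Indep (X ∪ ⁅ a ⁆) → a ∈Kᴹ X
  ∉∧indep⇒∈K {X} {a} a∉X iXa =
    ∣ X ∣ , indep⇒IsRank-∣∣ (indep-down (p⊆p∪q ⁅ a ⁆) iXa)
          , subst (IsRank M (X ∪ ⁅ a ⁆)) (x∉p⇒∣p∪⁅x⁆∣≡1+∣p∣ a∉X) (indep⇒IsRank-∣∣ iXa)

  ∈K⇒∉∧indep : ∀ {X a} → Indep X → a ∈Kᴹ X → a ∉ X × Indep (X ∪ ⁅ a ⁆)
  ∈K⇒∉∧indep {X} {a} iX (k , (_ , rX≤k) , ((A , A⊆Xa , iA , ∣A∣≡1+k) , _))
    with indep-aug iX iA (subst (∣ X ∣ <_) (sym ∣A∣≡1+k) (s≤s (rX≤k X ⊆-refl iX)))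
  ... | e , e∈A , e∉X , iXe with x∈p∪⁅y⁆⁻ X a (A⊆Xa e∈A)
  ...   | inj₁ e∈X = ⊥-elim (e∉X e∈X)
  ...   | inj₂ refl = e∉X , iXe

  ∈K? : ∀ {X} → Indep X → ∀ a → Dec (a ∈Kᴹ X)
  ∈K? {X} iX a =
    map′ (uncurry ∉∧indep⇒∈K) (∈K⇒∉∧indep iX) (¬? (a ∈? X) ×-dec indep-dec (X ∪ ⁅ a ⁆))

  parallel⇒∈K : ∀ {Y a c} → Indep Y → c ∈Kᴹ Y → Indep ⁅ a ⁆ → ¬ Indep (⁅ a ⁆ ∪ ⁅ c ⁆) →
                a ∈Kᴹ Y
  parallel⇒∈K {Y} {a} {c} iY c∈KY ia dep with ∈K⇒∉∧indep iY c∈KY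
  ... | c∉Y , iYc with extend-within ia iYc
  ... | K , a⊆K , K⊆aYc , iK , ∣Yc∣≤∣K∣ = ∉∧indep⇒∈K a∉Y (subst Indep K≡Ya iK)
    where
    pair⊆ : ∀ {S} → a ∈ S → c ∈ S → ⁅ a ⁆ ∪ ⁅ c ⁆ ⊆ S
    pair⊆ a∈S c∈S = ∪-least (x∈p⇒⁅x⁆⊆p a∈S) (x∈p⇒⁅x⁆⊆p c∈S)
    a∉Y : a ∉ Y
    a∉Y a∈Y = dep (indep-down (pair⊆ (p⊆p∪q ⁅ c ⁆ a∈Y) (x∈p∪⁅x⁆ Y c)) iYc)
    c∉K : c ∉ K
    c∉K c∈K = dep (indep-down (pair⊆ (a⊆K (x∈⁅x⁆ a)) c∈K) iK)
    K⊆Ya : K ⊆ Y ∪ ⁅ a ⁆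
    K⊆Ya x∈K with x∈p∪q⁻ ⁅ a ⁆ (Y ∪ ⁅ c ⁆) (K⊆aYc x∈K)
    ... | inj₁ x∈a = q⊆p∪q Y ⁅ a ⁆ x∈a
    ... | inj₂ x∈Yc with x∈p∪⁅y⁆⁻ Y c x∈Yc
    ...   | inj₁ x∈Y = p⊆p∪q ⁅ a ⁆ x∈Y
    ...   | inj₂ refl = ⊥-elim (c∉K x∈K)
    K≡Ya : K ≡ Y ∪ ⁅ a ⁆
    K≡Ya = p⊆q∧∣q∣≤∣p∣⇒p≡q K⊆Ya
             (≤-trans (≤-reflexive (trans (x∉p⇒∣p∪⁅x⁆∣≡1+∣p∣ a∉Y) (sym (x∉p⇒∣p∪⁅x⁆∣≡1+∣p∣ c∉Y))))
                      ∣Yc∣≤∣K∣)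

  secondary∧base⇒∉ : ∀ {X a} → Secondary M X → IsBase M (X ∪ ⁅ a ⁆) → a ∉ X
  secondary∧base⇒∉ {X} {a} (_ , B , bB , ∣B∣≡1+∣X∣) bXa a∈X =
    n≮n ∣ X ∣ (subst (_≤ ∣ X ∣) ∣B∣≡1+∣X∣
      (≤-trans (indep⇒∣∣≤∣base∣ (proj₁ bB) bXa)
               (p⊆q⇒∣p∣≤∣q∣ (∪-least ⊆-refl (x∈p⇒⁅x⁆⊆p a∈X)))))

  secondary∧∉∧indep⇒base : ∀ {X a} → Secondary M X → a ∉ X → Indep (X ∪ ⁅ a ⁆) →
                           IsBase M (X ∪ ⁅ a ⁆)
  secondary∧∉∧indep⇒base (_ , B , bB , ∣B∣≡1+∣X∣) a∉X iXa =
    indep∧∣base∣≤∣∣⇒base iXa bB (≤-reflexive (trans ∣B∣≡1+∣X∣ (sym (x∉p⇒∣p∪⁅x⁆∣≡1+∣p∣ a∉X))))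

  secondary∧∈K⇒base : ∀ {X a} → Secondary M X → a ∈Kᴹ X → IsBase M (X ∪ ⁅ a ⁆)
  secondary∧∈K⇒base sX a∈KX = uncurry (secondary∧∉∧indep⇒base sX) (∈K⇒∉∧indep (proj₁ sX) a∈KX)

  secondary∧base⇒∈K : ∀ {X a} → Secondary M X → IsBase M (X ∪ ⁅ a ⁆) → a ∈Kᴹ X
  secondary∧base⇒∈K sX bXa = ∉∧indep⇒∈K (secondary∧base⇒∉ sX bXa) (proj₁ bXa)

  base∧∈⇒secondary-minus : ∀ {B a} → IsBase M B → a ∈ B → Secondary M (B - a)
  base∧∈⇒secondary-minus {B} {a} bB a∈B =
    indep-down (p─q⊆p B ⁅ a ⁆) (proj₁ bB) , B , bB ,
    trans (cong ∣_∣ (sym (x∈p⇒p-x∪⁅x⁆≡p a∈B))) (x∉p⇒∣p∪⁅x⁆∣≡1+∣p∣ (x∉p-x B a))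

  base∧∈⇒∈K-minus : ∀ {B a} → IsBase M B → a ∈ B → a ∈Kᴹ (B - a)
  base∧∈⇒∈K-minus {B} {a} bB a∈B =
    ∉∧indep⇒∈K (x∉p-x B a) (subst Indep (sym (x∈p⇒p-x∪⁅x⁆≡p a∈B)) (proj₁ bB))

  secondary⇒∃∈K : ∀ {X} → Secondary M X → ∃[ a ] (a ∈Kᴹ X)
  secondary⇒∃∈K (iX , B , bB , ∣B∣≡1+∣X∣) with indep-aug iX (proj₁ bB) (≤-reflexive (sym ∣B∣≡1+∣X∣))
  ... | a , _ , a∉X , iXa = a , ∉∧indep⇒∈K a∉X iXa

  ∃secondary-∈K⇔∈base : ∀ a → (∃[ X ] (Secondary M X × a ∈Kᴹ X)) ⇔ InUnionOfBases M a
  ∃secondary-∈K⇔∈base a = mk⇔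
    (λ { (X , sX , a∈KX) → X ∪ ⁅ a ⁆ , secondary∧∈K⇒base sX a∈KX , x∈p∪⁅x⁆ X a })
    (λ { (B , bB , a∈B) → B - a , base∧∈⇒secondary-minus bB a∈B , base∧∈⇒∈K-minus bB a∈B })

  uniqueExpansion⇒pair-dependent : UniqueExpansion M → ∀ {X a c} → Secondary M X →
                                   a ∈Kᴹ X → c ∈Kᴹ X → Indep (⁅ a ⁆ ∪ ⁅ c ⁆) → a ≡ c
  uniqueExpansion⇒pair-dependent ue {X} {a} {c} sX a∈KX c∈KX iac
    with extend-to-base iac (secondary∧∈K⇒base sX c∈KX)
  ... | K , bK , ac⊆K =
    ue K X a c bK sX (ac⊆K (p⊆p∪q ⁅ c ⁆ (x∈⁅x⁆ a))) (ac⊆K (q⊆p∪q ⁅ a ⁆ ⁅ c ⁆ (x∈⁅x⁆ c)))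
       (secondary∧∈K⇒base sX a∈KX) (secondary∧∈K⇒base sX c∈KX)

  uniqueExpansion⇒∈K-transfer : UniqueExpansion M → ∀ {X Y a c} → Secondary M X → Secondary M Y →
                                c ∈Kᴹ X → c ∈Kᴹ Y → a ∈Kᴹ X → a ∈Kᴹ Y
  uniqueExpansion⇒∈K-transfer ue {X} {Y} {a} {c} sX sY c∈KX c∈KY a∈KX with indep-dec (⁅ a ⁆ ∪ ⁅ c ⁆)
  ... | yes iac = subst (_∈Kᴹ Y) (sym (uniqueExpansion⇒pair-dependent ue sX a∈KX c∈KX iac)) c∈KY
  ... | no dep  = parallel⇒∈K (proj₁ sY) c∈KY ia dep
    where
    ia : Indep ⁅ a ⁆
    ia = indep-down (q⊆p∪q X ⁅ a ⁆) (proj₂ (∈K⇒∉∧indep (proj₁ sX) a∈KX))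

  uniqueExpansion⇒formingIsPartition : UniqueExpansion M → FormingIsPartition M
  uniqueExpansion⇒formingIsPartition ue =
    (λ _ → secondary⇒∃∈K) , equal-or-disjoint , ∃secondary-∈K⇔∈base
    where
    equal-or-disjoint : ∀ X Y → Secondary M X → Secondary M Y →
                        (∀ a → (a ∈Kᴹ X) ⇔ (a ∈Kᴹ Y)) ⊎ (∀ a → a ∈Kᴹ X → a ∈Kᴹ Y → ⊥)
    equal-or-disjoint X Y sX sY with any? (λ a → ∈K? (proj₁ sX) a ×-dec ∈K? (proj₁ sY) a)
    ... | yes (c , c∈KX , c∈KY) = inj₁ λ a →
      mk⇔ (uniqueExpansion⇒∈K-transfer ue sX sY c∈KX c∈KY)
          (uniqueExpansion⇒∈K-transfer ue sY sX c∈KY c∈KX)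
    ... | no no-common = inj₂ λ a a∈KX a∈KY → no-common (a , a∈KX , a∈KY)

  formingIsPartition⇒uniqueExpansion : FormingIsPartition M → UniqueExpansion M
  formingIsPartition⇒uniqueExpansion (_ , equal-or-disjoint , _) B A e₁ e₂ bB sA e₁∈B e₂∈B bAe₁ bAe₂
    with e₁ ≟ e₂
  ... | yes e₁≡e₂ = e₁≡e₂
  ... | no e₁≢e₂ with equal-or-disjoint A (B - e₁) sA (base∧∈⇒secondary-minus bB e₁∈B)
  ...   | inj₁ same-block =
    ⊥-elim (proj₁ (∈K⇒∉∧indep (proj₁ (base∧∈⇒secondary-minus bB e₁∈B))
                             (Equivalence.to (same-block e₂) (secondary∧base⇒∈K sA bAe₂)))
                  (x∈p∧x≢y⇒x∈p-y e₂∈B (e₁≢e₂ ∘ sym)))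
  ...   | inj₂ disjoint = ⊥-elim (disjoint e₁ (secondary∧base⇒∈K sA bAe₁) (base∧∈⇒∈K-minus bB e₁∈B))

theorem4 : (n : ℕ) (M : Matroid n) → PositiveRank M →
           FormingIsPartition M ⇔ UniqueExpansion M
theorem4 n M _ = mk⇔ (formingIsPartition⇒uniqueExpansion M) (uniqueExpansion⇒formingIsPartition M)
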